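{- For any integers $i\ge1$ and $w\ge0$ and every $j\in\{0,\dots,w\}$, $\mathcal{P}_i[j]=\max\{\mathcal{P}_{i-1}[j_1]+\mathcal{P}_{i-1}[j_2]: j_1,j_2\in\{0,\dots,w\}, j_1+j_2=j\}$; i.e., $\mathcal{P}_i[0..w]$ equals $\mathcal{P}_{i-1}[0..w]\oplus\mathcal{P}_{i-1}[0..w]$ restricted to indices $0,\dots,w$.
   Context: Fix an \textsc{Unbounded Knapsack} item set $(p_1,w_1),\dots,(p_n,w_n)$ with $p_k,w_k\in\mathbb{N}$. For $x\in\mathbb{N}^n$, $p(x)=\sum_kp_kx_k$, $w(x)=\sum_kw_kx_k$, $\|x\|_1=\sum_kx_k$, and $\mathcal{P}_i[j]:=\max\{p(x): x\in\mathbb{N}^n, w(x)\le j, \|x\|_1\le 2^i\}$. $\oplus$ denotes $(\max,+)$-convolution: $(A\oplus B)[k]=\max_{i+j=k}A[i]+B[j]$. -}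

module Defs where

open import Data.Nat using (ℕ; zero; suc; _+_; _*_; _≤_; _^_)
open import Data.Fin using (Fin; zero; suc)
open import Data.Product using (Σ; _×_; ∃)
open import Relation.Binary.PropositionalEquality using (_≡_)

sumFin : (n : ℕ) → (Fin n → ℕ) → ℕ
sumFin zero    f = 0
sumFin (suc n) f = f zero + sumFin n (λ k → f (suc k))

-- An Unbounded Knapsack instance: n items with profits p k and weights wt k.
record Items : Set where
  field
    n  : ℕ
    p  : Fin n → ℕ
    wt : Fin n → ℕ

module _ (I : Items) where
  open Items I

  Sol : Set
  Sol = Fin n → ℕ

  profit : Sol → ℕ
  profit x = sumFin n (λ k → p k * x k)

  weight : Sol → ℕ
  weight x = sumFin n (λ k → wt k * x k)

  norm1 : Sol → ℕ
  norm1 x = sumFin n x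

  Achievable : ℕ → ℕ → ℕ → Set
  Achievable i j v = Σ Sol λ x → weight x ≤ j × norm1 x ≤ 2 ^ i × profit x ≡ v

IsMax : (ℕ → Set) → ℕ → Set
IsMax S v = S v × (∀ u → S u → u ≤ v)

-- P i j = 𝒫_i[j] := max{ p(x) : w(x) ≤ j, ‖x‖₁ ≤ 2^i }
IsPTable : Items → (ℕ → ℕ → ℕ) → Set
IsPTable I P = ∀ i j → IsMax (Achievable I i j) (P i j)

-- An optimal solution x with ‖x‖₁ ≤ 2^(i+1) splits coordinatewise into y + z with
-- ‖y‖₁, ‖z‖₁ ≤ 2^i; charging y the budget w(y) and z the rest j − w(y) gives
-- 𝒫_{i+1}[j] ≤ 𝒫_i[j₁] + 𝒫_i[j₂] with j₁ + j₂ = j. Conversely, the sum of two optimal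
-- solutions for budgets j₁, j₂ is feasible for 𝒫_{i+1}[j₁ + j₂].
module Submission where

open import Defs
open import Data.Nat using (ℕ; zero; suc; _+_; _*_; _∸_; _^_; _≤_; z≤n; s≤s; s≤s⁻¹)
open import Data.Nat.Properties
open import Data.Fin using (Fin; zero; suc)
open import Data.Product using (Σ; _×_; _,_; proj₁; proj₂)
open import Algebra.Properties.CommutativeSemigroup +-commutativeSemigroup using (interchange)
open import Relation.Binary.PropositionalEquality

sumFin-+ : ∀ n {x y z : Fin n → ℕ} → (∀ k → y k + z k ≡ x k) →
           sumFin n x ≡ sumFin n y + sumFin n z
sumFin-+ zero    e = refl
sumFin-+ (suc n) {x} {y} {z} e = begin
  x zero + sumFin n (λ k → x (suc k))
    ≡⟨ cong₂ _+_ (sym (e zero)) (sumFin-+ n (λ k → e (suc k))) ⟩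
  (y zero + z zero) + (sumFin n (λ k → y (suc k)) + sumFin n (λ k → z (suc k)))
    ≡⟨ interchange (y zero) (z zero) _ _ ⟩
  sumFin (suc n) y + sumFin (suc n) z ∎
  where open ≡-Reasoning

sumFin-*-+ : ∀ n (c : Fin n → ℕ) {x y z : Fin n → ℕ} → (∀ k → y k + z k ≡ x k) →
             sumFin n (λ k → c k * x k) ≡ sumFin n (λ k → c k * y k) + sumFin n (λ k → c k * z k)
sumFin-*-+ n c e = sumFin-+ n (λ k → trans (sym (*-distribˡ-+ (c k) _ _)) (cong (c k *_) (e k)))

-- Greedy: the units of a fill b first and overflow into c.
≤-+-split : ∀ a r b c → a + r ≤ b + c →
            Σ ℕ λ a₁ → Σ ℕ λ a₂ → a₁ + a₂ ≡ a × a₁ ≤ b × a₂ ≤ c × r ≤ (b ∸ a₁) + (c ∸ a₂)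
≤-+-split zero    r b       c       h = 0 , 0 , refl , z≤n , z≤n , h
≤-+-split (suc a) r (suc b) c       h with ≤-+-split a r b c (s≤s⁻¹ h)
... | a₁ , a₂ , e , a₁≤b , a₂≤c , r≤ = suc a₁ , a₂ , cong suc e , s≤s a₁≤b , a₂≤c , r≤
≤-+-split (suc a) r zero    (suc c) h with ≤-+-split a r zero c (s≤s⁻¹ h)
... | a₁ , a₂ , e , a₁≤0 , a₂≤c , r≤ =
  a₁ , suc a₂ , trans (+-suc a₁ a₂) (cong suc e) , a₁≤0 , s≤s a₂≤c , r≤

sumFin-split : ∀ n (x : Fin n → ℕ) b c → sumFin n x ≤ b + c →
               Σ (Fin n → ℕ) λ y → Σ (Fin n → ℕ) λ z →
               (∀ k → y k + z k ≡ x k) × sumFin n y ≤ b × sumFin n z ≤ c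
sumFin-split zero    x b c h = (λ ()) , (λ ()) , (λ ()) , z≤n , z≤n
sumFin-split (suc n) x b c h
  with ≤-+-split (x zero) (sumFin n (λ k → x (suc k))) b c h
... | a₁ , a₂ , e , a₁≤b , a₂≤c , rest≤
  with sumFin-split n (λ k → x (suc k)) (b ∸ a₁) (c ∸ a₂) rest≤
... | y , z , e′ , y≤ , z≤ =
  (λ { zero → a₁ ; (suc k) → y k }) ,
  (λ { zero → a₂ ; (suc k) → z k }) ,
  (λ { zero → e ; (suc k) → e′ k }) ,
  ≤-trans (+-monoʳ-≤ a₁ y≤) (≤-reflexive (m+[n∸m]≡n a₁≤b)) ,
  ≤-trans (+-monoʳ-≤ a₂ z≤) (≤-reflexive (m+[n∸m]≡n a₂≤c))

2^i+2^i≡2^[1+i] : ∀ i → 2 ^ i + 2 ^ i ≡ 2 ^ suc i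
2^i+2^i≡2^[1+i] i = cong (2 ^ i +_) (sym (+-identityʳ (2 ^ i)))

module _ (I : Items) where
  open Items I

  Achievable-+ : ∀ {i j₁ j₂ v₁ v₂} → Achievable I i j₁ v₁ → Achievable I i j₂ v₂ →
                 Achievable I (suc i) (j₁ + j₂) (v₁ + v₂)
  Achievable-+ {i} (x₁ , w₁ , n₁ , p₁) (x₂ , w₂ , n₂ , p₂) =
    (λ k → x₁ k + x₂ k) ,
    subst (_≤ _) (sym (sumFin-*-+ n wt pointwise)) (+-mono-≤ w₁ w₂) ,
    subst₂ _≤_ (sym (sumFin-+ n pointwise)) (2^i+2^i≡2^[1+i] i) (+-mono-≤ n₁ n₂) ,
    trans (sumFin-*-+ n p pointwise) (cong₂ _+_ p₁ p₂)
    where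
    pointwise : ∀ k → x₁ k + x₂ k ≡ x₁ k + x₂ k
    pointwise k = refl

  Achievable-split : ∀ {i j v} → Achievable I (suc i) j v →
                     Σ ℕ λ j₁ → Σ ℕ λ v₁ → Σ ℕ λ v₂ →
                     j₁ ≤ j × v₁ + v₂ ≡ v × Achievable I i j₁ v₁ × Achievable I i (j ∸ j₁) v₂
  Achievable-split {i} {j} (x , wx≤j , nx≤ , px≡v)
    with sumFin-split n x (2 ^ i) (2 ^ i) (subst (norm1 I x ≤_) (sym (2^i+2^i≡2^[1+i] i)) nx≤)
  ... | y , z , y+z≡x , ny≤ , nz≤ =
    weight I y , profit I y , profit I z ,
    m+n≤o⇒m≤o (weight I y) wy+wz≤j ,
    trans (sym (sumFin-*-+ n p y+z≡x)) px≡v ,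
    (y , ≤-refl , ny≤ , refl) ,
    (z , m+n≤o⇒m≤o∸n (weight I z) (subst (_≤ j) (+-comm (weight I y) _) wy+wz≤j) , nz≤ , refl)
    where
    wy+wz≤j : weight I y + weight I z ≤ j
    wy+wz≤j = subst (_≤ j) (sumFin-*-+ n wt y+z≡x) wx≤j

  module _ {P : ℕ → ℕ → ℕ} (isP : IsPTable I P) where

    P-superadditive : ∀ i j₁ j₂ → P i j₁ + P i j₂ ≤ P (suc i) (j₁ + j₂)
    P-superadditive i j₁ j₂ =
      isP (suc i) (j₁ + j₂) .proj₂ _ (Achievable-+ {i} (isP i j₁ .proj₁) (isP i j₂ .proj₁))

    P-suc-split : ∀ i j → Σ ℕ λ j₁ → j₁ ≤ j × P (suc i) j ≡ P i j₁ + P i (j ∸ j₁)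
    P-suc-split i j with Achievable-split {i} (isP (suc i) j .proj₁)
    ... | j₁ , v₁ , v₂ , j₁≤j , v₁+v₂≡P , y , z =
      j₁ , j₁≤j , ≤-antisym upper lower
      where
      upper : P (suc i) j ≤ P i j₁ + P i (j ∸ j₁)
      upper = subst (_≤ P i j₁ + P i (j ∸ j₁)) v₁+v₂≡P
                (+-mono-≤ (isP i j₁ .proj₂ v₁ y) (isP i (j ∸ j₁) .proj₂ v₂ z))

      lower : P i j₁ + P i (j ∸ j₁) ≤ P (suc i) j
      lower = subst (λ t → P i j₁ + P i (j ∸ j₁) ≤ P (suc i) t) (m+[n∸m]≡n j₁≤j)
                (P-superadditive i j₁ (j ∸ j₁))

lemma5p1 : (I : Items) → (P : ℕ → ℕ → ℕ) → IsPTable I P →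
    (i w j : ℕ) → j ≤ w →
    IsMax (λ v → Σ ℕ λ j₁ → Σ ℕ λ j₂ →
             j₁ ≤ w × j₂ ≤ w × j₁ + j₂ ≡ j × v ≡ P i j₁ + P i j₂)
          (P (suc i) j)
lemma5p1 I P isP i w j j≤w = attained , bounded
  where
  attained : Σ ℕ λ j₁ → Σ ℕ λ j₂ →
             j₁ ≤ w × j₂ ≤ w × j₁ + j₂ ≡ j × P (suc i) j ≡ P i j₁ + P i j₂
  attained with P-suc-split I isP i j
  ... | j₁ , j₁≤j , P≡ =
    j₁ , j ∸ j₁ , ≤-trans j₁≤j j≤w , ≤-trans (m∸n≤m j j₁) j≤w , m+[n∸m]≡n j₁≤j , P≡

  bounded : ∀ u → (Σ ℕ λ j₁ → Σ ℕ λ j₂ →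
                   j₁ ≤ w × j₂ ≤ w × j₁ + j₂ ≡ j × u ≡ P i j₁ + P i j₂) → u ≤ P (suc i) j
  bounded u (j₁ , j₂ , _ , _ , refl , refl) = P-superadditive I isP i j₁ j₂
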